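{- Let $n,k$ be integers with $2\le 2k\le n-4$, and let $\lambda\in\overline{\mathcal{U}}_{T_{n,n-2k}}$ with largest part $2n-5$. Then the Keith--Nath Young diagram $Y_{S_\lambda}$ has exactly $2n-3+2k$ cells; consequently the sum of the hook lengths along its main diagonal is $2n-3+2k$.
   Context: Partitions into distinct parts: $\lambda=(\lambda_1<\dots<\lambda_t)$, $t\ge2$. Missing parts $\mathcal{M}_\lambda=\{1,\dots,\lambda_t\}\setminus\{\lambda_i\}$. Unrefinable: no two distinct missing parts sum to a part. Maximal: largest part is maximum among unrefinable partitions of the same integer. $\overline{\mathcal{U}}_N$: maximal unrefinable partitions of $N$ with $\#\mathcal{M}_\lambda=\lfloor\lambda_t/2\rfloor$. $T_n=n(n+1)/2$, $T_{n,d}=T_n-d$. $S_\lambda=\mathbb{N}_0\setminus\lambda$; $Y_{S_\lambda}$ (English convention) has one row per part $g$ of $\lambda$, ordered top to bottom by decreasing $g$, the row of $g$ having $\#\{s\in S_\lambda:s<g\}$ cells. Hook length = arm + leg + 1. -}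

module Defs where

open import Data.Nat using (ℕ; zero; suc; _+_; _*_; _∸_; _≤_; _<_; _≤?_; _⊔_; _/_)
open import Data.Nat.Properties using (_≟_)
open import Data.List using (List; []; _∷_; length; map; filter; upTo; foldr; reverse)
open import Data.Nat.ListAction using (sum)
open import Data.List.Relation.Unary.All using (All)
open import Data.List.Relation.Unary.Linked using (Linked)
open import Data.List.Membership.Propositional using (_∈_; _∉_)
open import Data.List.Membership.DecPropositional _≟_ using (_∈?_)
open import Data.Product using (_×_)
open import Relation.Nullary using (¬_; ¬?; yes; no)
open import Relation.Binary.PropositionalEquality using (_≡_; _≢_)

IsDistinctPartition : List ℕ → Set
IsDistinctPartition xs = Linked _<_ xs × All (0 <_) xs × 2 ≤ length xs

largest : List ℕ → ℕ
largest xs = foldr _⊔_ 0 xs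

missing : List ℕ → List ℕ
missing xs = filter (λ m → ¬? (m ∈? xs)) (map suc (upTo (largest xs)))

Unrefinable : List ℕ → Set
Unrefinable xs = ∀ a b → a ∈ missing xs → b ∈ missing xs → a ≢ b → (a + b) ∉ xs

Maximal : List ℕ → Set
Maximal xs = ∀ ys → IsDistinctPartition ys → Unrefinable ys → sum ys ≡ sum xs →
             largest ys ≤ largest xs

InUbar : ℕ → List ℕ → Set
InUbar N xs = IsDistinctPartition xs × Unrefinable xs × Maximal xs × sum xs ≡ N
            × length (missing xs) ≡ largest xs / 2

T : ℕ → ℕ
T n = (n * suc n) / 2

Tnd : ℕ → ℕ → ℕ
Tnd n d = T n ∸ d

-- length of the row of part g in Y_{S_λ}: #{s ∈ S_λ : s < g}, S_λ = ℕ₀ \ λ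
rowLen : List ℕ → ℕ → ℕ
rowLen xs g = length (filter (λ s → ¬? (s ∈? xs)) (upTo g))

rows : List ℕ → List ℕ
rows xs = map (rowLen xs) (reverse xs)

cells : List ℕ → ℕ
cells rs = sum rs

-- sum of hook lengths of the diagonal cells (i,i), rows indexed from i
-- hook = arm + leg + 1, arm = r_i - i, leg = #{j > i : r_j ≥ i}
diagHooksFrom : ℕ → List ℕ → ℕ
diagHooksFrom i [] = 0
diagHooksFrom i (r ∷ rest) with i ≤? r
... | yes _ = ((r ∸ i) + length (filter (i ≤?_) rest) + 1) + diagHooksFrom (suc i) rest
... | no _ = diagHooksFrom (suc i) rest

diagonalHookSum : List ℕ → ℕ
diagonalHookSum rs = diagHooksFrom 1 rs

-- List the parts increasingly as λ₁ < … < λ_t. Exactly i − 1 parts lie below λ_i, so its row in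
-- Y_{S_λ} has λ_i − (i − 1) cells and |Y| = |λ| − (0 + 1 + … + (t − 1)). The hypotheses pin down t:
-- the missing parts and the parts together fill {1, …, λ_t}, so t = (2n − 5) − (n − 3) = n − 2, and
-- with |λ| = T_n − (n − 2k) this gives |Y| = 2n − 3 + 2k. The rows are weakly decreasing, and in a Young diagram the
-- diagonal hooks from column p + 1 on partition the cells to the right of column p, so the diagonal
-- hook lengths sum to |Y|.

{-# OPTIONS --safe #-}
module Submission where

open import Defs
open import Function using (_∘_; flip)
open import Data.Nat using (ℕ; zero; suc; _+_; _*_; _∸_; _≤_; _<_; _≥_; _≤′_; ≤′-refl; ≤′-step; _<?_; _≤?_; _/_; z≤n; s≤s; s≤s⁻¹)
open import Data.Nat.Properties
open import Data.Nat.DivMod using (m*n/n≡m; +-distrib-/-∣ʳ; /-congˡ)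
open import Data.Nat.Divisibility using (n∣m*n)
open import Data.Nat.ListAction using (sum)
open import Data.Nat.ListAction.Properties using (sum-++; sum-↭)
open import Data.Nat.Tactic.RingSolver using (solve-∀)
open import Algebra.Properties.CommutativeSemigroup +-commutativeSemigroup using (interchange)
open import Data.List using (List; []; _∷_; [_]; length; map; filter; upTo; applyUpTo; reverse; _++_)
open import Data.List.Properties
  using (length-++; filter-++; filter-accept; filter-reject; filter-all; filter-none;
         upTo-∷ʳ; map-upTo; map-id; map-∘; map-cong; map-cong-local; reverse-map; unfold-reverse)
open import Data.List.Relation.Unary.All as All using (All; []; _∷_)
open import Data.List.Relation.Unary.AllPairs as AllPairs using (AllPairs; []; _∷_)
import Data.List.Relation.Unary.AllPairs.Properties as AllPairs
open import Data.List.Relation.Unary.Linked.Properties using (Linked⇒AllPairs)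
open import Data.List.Relation.Unary.Any using (here; there)
open import Data.List.Relation.Binary.Permutation.Propositional using (↭-sym)
open import Data.List.Relation.Binary.Permutation.Propositional.Properties using (↭-reverse; All-resp-↭)
open import Data.List.Membership.Propositional using (_∈_; _∉_)
open import Data.List.Membership.DecPropositional _≟_ using (_∈?_)
open import Data.Product using (_×_; ∃-syntax; _,_)
open import Relation.Binary using (Rel)
open import Relation.Nullary using (¬_; ¬?; yes; no; contradiction)
open import Relation.Binary.PropositionalEquality using (_≡_; refl; sym; trans; cong; cong₂; subst; module ≡-Reasoning)
open ≡-Reasoning

AllPairs-reverse⁺ : ∀ {a ℓ} {A : Set a} {R : Rel A ℓ} {xs : List A} →
                    AllPairs R xs → AllPairs (flip R) (reverse xs)
AllPairs-reverse⁺ [] = []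
AllPairs-reverse⁺ {R = R} {x ∷ xs} (x~xs ∷ xs~) =
  subst (AllPairs (flip R)) (sym (unfold-reverse x xs))
    (AllPairs.++⁺ (AllPairs-reverse⁺ xs~) ([] ∷ [])
      (All.map (_∷ []) (All-resp-↭ (↭-sym (↭-reverse xs)) x~xs)))

sum-map-+ : ∀ {a} {A : Set a} (f g : A → ℕ) xs →
            sum (map f xs) + sum (map g xs) ≡ sum (map (λ x → f x + g x) xs)
sum-map-+ f g [] = refl
sum-map-+ f g (x ∷ xs) =
  trans (interchange (f x) _ (g x) _) (cong (f x + g x +_) (sum-map-+ f g xs))

sum-map-reverse : ∀ {a} {A : Set a} (f : A → ℕ) xs → sum (map f (reverse xs)) ≡ sum (map f xs)
sum-map-reverse f xs = trans (cong sum (reverse-map f xs)) (sum-↭ (↭-reverse (map f xs)))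

countBelow : List ℕ → ℕ → ℕ
countBelow xs g = length (filter (_<? g) xs)

countBelow-∷-< : ∀ {x g} xs → x < g → countBelow (x ∷ xs) g ≡ suc (countBelow xs g)
countBelow-∷-< {g = g} _ x<g = cong length (filter-accept (_<? g) x<g)

countBelow-∷-≮ : ∀ {x g} xs → ¬ x < g → countBelow (x ∷ xs) g ≡ countBelow xs g
countBelow-∷-≮ {g = g} _ x≮g = cong length (filter-reject (_<? g) x≮g)

countBelow-≤ : ∀ {xs g} → All (g ≤_) xs → countBelow xs g ≡ 0
countBelow-≤ {g = g} g≤xs = cong length (filter-none (_<? g) (All.map ≤⇒≯ g≤xs))

countBelow-suc-∉ : ∀ {g} xs → g ∉ xs → countBelow xs (suc g) ≡ countBelow xs g
countBelow-suc-∉ [] _ = refl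
countBelow-suc-∉ {g} (x ∷ xs) g∉x∷xs with x <? g
... | yes x<g = begin
  countBelow (x ∷ xs) (suc g) ≡⟨ countBelow-∷-< xs (m<n⇒m<1+n x<g) ⟩
  suc (countBelow xs (suc g)) ≡⟨ cong suc (countBelow-suc-∉ xs (g∉x∷xs ∘ there)) ⟩
  suc (countBelow xs g)       ≡⟨ countBelow-∷-< xs x<g ⟨
  countBelow (x ∷ xs) g       ∎
... | no x≮g = begin
  countBelow (x ∷ xs) (suc g) ≡⟨ countBelow-∷-≮ xs x≮1+g ⟩
  countBelow xs (suc g)       ≡⟨ countBelow-suc-∉ xs (g∉x∷xs ∘ there) ⟩
  countBelow xs g             ≡⟨ countBelow-∷-≮ xs x≮g ⟨
  countBelow (x ∷ xs) g       ∎
  where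
  x≮1+g : ¬ x < suc g
  x≮1+g x<1+g = g∉x∷xs (here (≤-antisym (≮⇒≥ x≮g) (s≤s⁻¹ x<1+g)))

countBelow-suc-∈ : ∀ {g xs} → AllPairs _<_ xs → g ∈ xs → countBelow xs (suc g) ≡ suc (countBelow xs g)
countBelow-suc-∈ {xs = x ∷ xs} (x<xs ∷ _) (here refl) = begin
  countBelow (x ∷ xs) (suc x) ≡⟨ countBelow-∷-< xs (n<1+n x) ⟩
  suc (countBelow xs (suc x)) ≡⟨ cong suc (countBelow-suc-∉ xs x∉xs) ⟩
  suc (countBelow xs x)       ≡⟨ cong suc (countBelow-∷-≮ xs (n≮n x)) ⟨
  suc (countBelow (x ∷ xs) x) ∎
  where
  x∉xs : x ∉ xs
  x∉xs x∈xs = n≮n x (All.lookup x<xs x∈xs)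
countBelow-suc-∈ {g} {x ∷ xs} (x<xs ∷ xs<) (there g∈xs) = begin
  countBelow (x ∷ xs) (suc g)   ≡⟨ countBelow-∷-< xs (m<n⇒m<1+n x<g) ⟩
  suc (countBelow xs (suc g))   ≡⟨ cong suc (countBelow-suc-∈ xs< g∈xs) ⟩
  suc (suc (countBelow xs g))   ≡⟨ cong suc (countBelow-∷-< xs x<g) ⟨
  suc (countBelow (x ∷ xs) g)   ∎
  where x<g = All.lookup x<xs g∈xs

map-countBelow≡upTo : ∀ {xs} → AllPairs _<_ xs → map (countBelow xs) xs ≡ upTo (length xs)
map-countBelow≡upTo [] = refl
map-countBelow≡upTo {x ∷ xs} (x<xs ∷ xs<) =
  cong₂ _∷_ (countBelow-≤ (≤-refl ∷ All.map <⇒≤ x<xs)) (begin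
  map (countBelow (x ∷ xs)) xs  ≡⟨ map-cong-local (All.map (countBelow-∷-< xs) x<xs) ⟩
  map (suc ∘ countBelow xs) xs  ≡⟨ map-∘ xs ⟩
  map suc (map (countBelow xs) xs) ≡⟨ cong (map suc) (map-countBelow≡upTo xs<) ⟩
  map suc (upTo (length xs))    ≡⟨ map-upTo suc (length xs) ⟩
  applyUpTo suc (length xs)     ∎)

rowLen-suc : ∀ xs g → rowLen xs (suc g) ≡ rowLen xs g + length (filter (λ s → ¬? (s ∈? xs)) [ g ])
rowLen-suc xs g = begin
  length (filter ∉? (upTo (suc g)))         ≡⟨ cong (length ∘ filter ∉?) (upTo-∷ʳ g) ⟨
  length (filter ∉? (upTo g ++ [ g ]))      ≡⟨ cong length (filter-++ ∉? (upTo g) [ g ]) ⟩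
  length (filter ∉? (upTo g) ++ filter ∉? [ g ]) ≡⟨ length-++ (filter ∉? (upTo g)) ⟩
  rowLen xs g + length (filter ∉? [ g ])    ∎
  where ∉? = λ s → ¬? (s ∈? xs)

rowLen-suc-∈ : ∀ {xs g} → g ∈ xs → rowLen xs (suc g) ≡ rowLen xs g
rowLen-suc-∈ {xs} {g} g∈xs = begin
  rowLen xs (suc g)                              ≡⟨ rowLen-suc xs g ⟩
  rowLen xs g + length (filter ∉? [ g ])
    ≡⟨ cong (λ l → rowLen xs g + length l) (filter-reject ∉? (λ g∉xs → g∉xs g∈xs)) ⟩
  rowLen xs g + 0                                ≡⟨ +-identityʳ (rowLen xs g) ⟩
  rowLen xs g                                    ∎
  where ∉? = λ s → ¬? (s ∈? xs)

rowLen-suc-∉ : ∀ {xs g} → g ∉ xs → rowLen xs (suc g) ≡ suc (rowLen xs g)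
rowLen-suc-∉ {xs} {g} g∉xs = begin
  rowLen xs (suc g)                              ≡⟨ rowLen-suc xs g ⟩
  rowLen xs g + length (filter ∉? [ g ])
    ≡⟨ cong (λ l → rowLen xs g + length l) (filter-accept ∉? g∉xs) ⟩
  rowLen xs g + 1                                ≡⟨ +-comm (rowLen xs g) 1 ⟩
  suc (rowLen xs g)                              ∎
  where ∉? = λ s → ¬? (s ∈? xs)

rowLen+countBelow : ∀ {xs} → AllPairs _<_ xs → ∀ g → rowLen xs g + countBelow xs g ≡ g
rowLen+countBelow {xs} xs< zero = countBelow-≤ {xs} (All.tabulate (λ _ → z≤n))
rowLen+countBelow {xs} xs< (suc g) with g ∈? xs
... | yes g∈xs = begin
  rowLen xs (suc g) + countBelow xs (suc g) ≡⟨ cong₂ _+_ (rowLen-suc-∈ g∈xs) (countBelow-suc-∈ xs< g∈xs) ⟩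
  rowLen xs g + suc (countBelow xs g)       ≡⟨ +-suc (rowLen xs g) (countBelow xs g) ⟩
  suc (rowLen xs g + countBelow xs g)       ≡⟨ cong suc (rowLen+countBelow xs< g) ⟩
  suc g                                     ∎
... | no g∉xs = begin
  rowLen xs (suc g) + countBelow xs (suc g) ≡⟨ cong₂ _+_ (rowLen-suc-∉ g∉xs) (countBelow-suc-∉ xs g∉xs) ⟩
  suc (rowLen xs g + countBelow xs g)       ≡⟨ cong suc (rowLen+countBelow xs< g) ⟩
  suc g                                     ∎

rowLen-mono-≤′ : ∀ xs {g h} → g ≤′ h → rowLen xs g ≤ rowLen xs h
rowLen-mono-≤′ xs ≤′-refl = ≤-refl
rowLen-mono-≤′ xs {g} (≤′-step {h} g≤′h) =
  ≤-trans (rowLen-mono-≤′ xs g≤′h) (≤-trans (m≤m+n _ _) (≤-reflexive (sym (rowLen-suc xs h))))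

rows-sorted : ∀ {xs} → AllPairs _<_ xs → AllPairs _≥_ (rows xs)
rows-sorted {xs} xs< =
  AllPairs.map⁺ (AllPairs.map (rowLen-mono-≤′ xs ∘ ≤⇒≤′ ∘ <⇒≤) (AllPairs-reverse⁺ xs<))

cells-rows : ∀ {xs} → AllPairs _<_ xs → cells (rows xs) + sum (upTo (length xs)) ≡ sum xs
cells-rows {xs} xs< = begin
  sum (map (rowLen xs) (reverse xs)) + sum (upTo (length xs))
    ≡⟨ cong₂ _+_ (sum-map-reverse (rowLen xs) xs) (cong sum (sym (map-countBelow≡upTo xs<))) ⟩
  sum (map (rowLen xs) xs) + sum (map (countBelow xs) xs)
    ≡⟨ sum-map-+ (rowLen xs) (countBelow xs) xs ⟩
  sum (map (λ g → rowLen xs g + countBelow xs g) xs)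
    ≡⟨ cong sum (trans (map-cong (rowLen+countBelow xs<) xs) (map-id xs)) ⟩
  sum xs ∎

xs≤largest : ∀ xs → All (_≤ largest xs) xs
xs≤largest [] = []
xs≤largest (x ∷ xs) =
  m≤m⊔n x (largest xs) ∷ All.map (λ y≤ → ≤-trans y≤ (m≤n⊔m x (largest xs))) (xs≤largest xs)

rowLen-suc-largest : ∀ xs → 0 ∉ xs → rowLen xs (suc (largest xs)) ≡ suc (length (missing xs))
rowLen-suc-largest xs 0∉xs = begin
  length (filter ∉? (0 ∷ applyUpTo suc (largest xs)))  ≡⟨ cong length (filter-accept ∉? 0∉xs) ⟩
  suc (length (filter ∉? (applyUpTo suc (largest xs))))
    ≡⟨ cong (suc ∘ length ∘ filter ∉?) (map-upTo suc (largest xs)) ⟨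
  suc (length (missing xs)) ∎
  where ∉? = λ s → ¬? (s ∈? xs)

length-missing : ∀ {xs} → AllPairs _<_ xs → All (0 <_) xs → length (missing xs) + length xs ≡ largest xs
length-missing {xs} xs< 0<xs = suc-injective (begin
  suc (length (missing xs)) + length xs  ≡⟨ cong (_+ length xs) (rowLen-suc-largest xs 0∉xs) ⟨
  rowLen xs (suc L) + length xs          ≡⟨ cong (rowLen xs (suc L) +_) countBelow≡length ⟨
  rowLen xs (suc L) + countBelow xs (suc L) ≡⟨ rowLen+countBelow xs< (suc L) ⟩
  suc L ∎)
  where
  L = largest xs
  0∉xs : 0 ∉ xs
  0∉xs 0∈xs = n≮n 0 (All.lookup 0<xs 0∈xs)
  countBelow≡length : countBelow xs (suc L) ≡ length xs
  countBelow≡length = cong length (filter-all (_<? suc L) (All.map s≤s (xs≤largest xs)))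

∸≡suc[∸suc] : ∀ {r p} → p < r → r ∸ p ≡ suc (r ∸ suc p)
∸≡suc[∸suc] {suc r} {zero} _ = refl
∸≡suc[∸suc] {suc r} {suc p} (s≤s p<r) = ∸≡suc[∸suc] p<r

sum-map-∸ : ∀ p rs → sum (map (_∸ p) rs) ≡ sum (map (_∸ suc p) rs) + length (filter (suc p ≤?_) rs)
sum-map-∸ p [] = refl
sum-map-∸ p (r ∷ rs) with suc p ≤? r
... | yes p<r = begin
  r ∸ p + sum (map (_∸ p) rs)  ≡⟨ cong₂ _+_ (∸≡suc[∸suc] p<r) (sum-map-∸ p rs) ⟩
  suc (r ∸ suc p + (A + B))    ≡⟨ cong suc (+-assoc (r ∸ suc p) A B) ⟨
  suc (r ∸ suc p + A + B)      ≡⟨ +-suc (r ∸ suc p + A) B ⟨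
  r ∸ suc p + A + suc B        ≡⟨ cong (λ l → r ∸ suc p + A + length l) (filter-accept (suc p ≤?_) p<r) ⟨
  r ∸ suc p + A + length (filter (suc p ≤?_) (r ∷ rs)) ∎
  where
  A = sum (map (_∸ suc p) rs)
  B = length (filter (suc p ≤?_) rs)
... | no p≮r = begin
  r ∸ p + sum (map (_∸ p) rs)  ≡⟨ cong₂ _+_ (m≤n⇒m∸n≡0 r≤p) (sum-map-∸ p rs) ⟩
  A + B                        ≡⟨ cong (λ z → z + A + B) (m≤n⇒m∸n≡0 (m≤n⇒m≤1+n r≤p)) ⟨
  r ∸ suc p + A + B            ≡⟨ cong (λ l → r ∸ suc p + A + length l) (filter-reject (suc p ≤?_) p≮r) ⟨
  r ∸ suc p + A + length (filter (suc p ≤?_) (r ∷ rs)) ∎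
  where
  r≤p = s≤s⁻¹ (≰⇒> p≮r)
  A = sum (map (_∸ suc p) rs)
  B = length (filter (suc p ≤?_) rs)

sum-map-∸≡0 : ∀ {q rs} → All (_≤ q) rs → sum (map (_∸ q) rs) ≡ 0
sum-map-∸≡0 [] = refl
sum-map-∸≡0 (r≤q ∷ rs≤q) = cong₂ _+_ (m≤n⇒m∸n≡0 r≤q) (sum-map-∸≡0 rs≤q)

diagHooksFrom-suc : ∀ p {rs} → AllPairs _≥_ rs → diagHooksFrom (suc p) rs ≡ sum (map (_∸ p) rs)
diagHooksFrom-suc p [] = refl
diagHooksFrom-suc p {r ∷ rs} (r≥rs ∷ rs≥) with suc p ≤? r
... | yes p<r = begin
  r ∸ suc p + B + 1 + diagHooksFrom (suc (suc p)) rs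
    ≡⟨ cong (r ∸ suc p + B + 1 +_) (diagHooksFrom-suc (suc p) rs≥) ⟩
  r ∸ suc p + B + 1 + sum (map (_∸ suc p) rs)
    ≡⟨ rearrange (r ∸ suc p) B _ ⟩
  suc (r ∸ suc p) + (sum (map (_∸ suc p) rs) + B)
    ≡⟨ cong₂ _+_ (∸≡suc[∸suc] p<r) (sum-map-∸ p rs) ⟨
  r ∸ p + sum (map (_∸ p) rs) ∎
  where
  B = length (filter (suc p ≤?_) rs)
  rearrange : ∀ a b c → a + b + 1 + c ≡ suc a + (c + b)
  rearrange = solve-∀
... | no p≮r = begin
  diagHooksFrom (suc (suc p)) rs ≡⟨ diagHooksFrom-suc (suc p) rs≥ ⟩
  sum (map (_∸ suc p) rs)        ≡⟨ sum-map-∸≡0 (All.map (flip ≤-trans (m≤n⇒m≤1+n r≤p)) r≥rs) ⟩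
  0                              ≡⟨ cong₂ _+_ (m≤n⇒m∸n≡0 r≤p) (sum-map-∸≡0 (All.map (flip ≤-trans r≤p) r≥rs)) ⟨
  r ∸ p + sum (map (_∸ p) rs) ∎
  where
  r≤p = s≤s⁻¹ (≰⇒> p≮r)

diagonalHookSum≡cells : ∀ {rs} → AllPairs _≥_ rs → diagonalHookSum rs ≡ cells rs
diagonalHookSum≡cells {rs} rs≥ = trans (diagHooksFrom-suc 0 rs≥) (cong sum (map-id rs))

T-suc : ∀ t → T (suc t) ≡ T t + suc t
T-suc t = begin
  suc t * suc (suc t) / 2       ≡⟨ /-congˡ (expand t) ⟩
  (t * suc t + suc t * 2) / 2   ≡⟨ +-distrib-/-∣ʳ (t * suc t) (n∣m*n (suc t)) ⟩
  T t + suc t * 2 / 2           ≡⟨ cong (T t +_) (m*n/n≡m (suc t) 2) ⟩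
  T t + suc t ∎
  where
  expand : ∀ t → suc t * suc (suc t) ≡ t * suc t + suc t * 2
  expand = solve-∀

sum-upTo+n≡T : ∀ t → sum (upTo t) + t ≡ T t
sum-upTo+n≡T zero = refl
sum-upTo+n≡T (suc t) = begin
  sum (upTo (suc t)) + suc t       ≡⟨ cong (λ l → sum l + suc t) (upTo-∷ʳ t) ⟨
  sum (upTo t ++ [ t ]) + suc t    ≡⟨ cong (_+ suc t) (sum-++ (upTo t) [ t ]) ⟩
  sum (upTo t) + (t + 0) + suc t   ≡⟨ cong (λ z → sum (upTo t) + z + suc t) (+-identityʳ t) ⟩
  sum (upTo t) + t + suc t         ≡⟨ cong (_+ suc t) (sum-upTo+n≡T t) ⟩
  T t + suc t                      ≡⟨ T-suc t ⟨
  T (suc t) ∎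

half-odd : ∀ m → (1 + m * 2) / 2 ≡ m
half-odd m = trans (+-distrib-/-∣ʳ 1 {d = 2} (n∣m*n m)) (m*n/n≡m m 2)

complement-of-half-odd : ∀ m {p t} → p + t ≡ 1 + m * 2 → p ≡ (1 + m * 2) / 2 → t ≡ suc m
complement-of-half-odd m {p} {t} p+t≡ p≡ = +-cancelˡ-≡ m t (suc m) (begin
  m + t        ≡⟨ cong (_+ t) (trans p≡ (half-odd m)) ⟨
  p + t        ≡⟨ p+t≡ ⟩
  1 + m * 2    ≡⟨ split m ⟩
  m + suc m    ∎)
  where
  split : ∀ m → 1 + m * 2 ≡ m + suc m
  split = solve-∀

2[4+m]∸5≡1+[1+m]*2 : ∀ m → 2 * (4 + m) ∸ 5 ≡ 1 + suc m * 2
2[4+m]∸5≡1+[1+m]*2 m = cong (_∸ 5) (expand m)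
  where
  expand : ∀ m → 2 * (4 + m) ≡ 5 + (1 + suc m * 2)
  expand = solve-∀

-- T (4 + m) = sum (upTo (2 + m)) + (3m + 9) and (4 + m) ∸ 2k = 4 + e, so c = 5 + 2m + 2k as m = 2k + e.
cells-arithmetic : ∀ k e c → let m = 2 * k + e in
  c + sum (upTo (2 + m)) ≡ Tnd (4 + m) (4 + m ∸ 2 * k) → c ≡ 2 * (4 + m) ∸ 3 + 2 * k
cells-arithmetic k e c c+U≡ = begin
  c                         ≡⟨ +-cancelʳ-≡ U c (5 + 2 * m + 2 * k) c+U≡5+2m+2k+U ⟩
  5 + 2 * m + 2 * k         ≡⟨ cong (λ z → z ∸ 3 + 2 * k) (expand k e) ⟨
  2 * (4 + m) ∸ 3 + 2 * k   ∎
  where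
  m = 2 * k + e
  U = sum (upTo (2 + m))
  expand : ∀ k e → 2 * (4 + (2 * k + e)) ≡ 3 + (5 + 2 * (2 * k + e))
  expand = solve-∀
  regroup : ∀ k e U → let m = 2 * k + e in
            U + (2 + m) + (3 + m) + (4 + m) ≡ 5 + 2 * m + 2 * k + U + (4 + e)
  regroup = solve-∀
  reorder : ∀ k e → 4 + (2 * k + e) ≡ 2 * k + (4 + e)
  reorder = solve-∀
  4+m∸2k≡4+e : 4 + m ∸ 2 * k ≡ 4 + e
  4+m∸2k≡4+e = trans (cong (_∸ 2 * k) (reorder k e)) (m+n∸m≡n (2 * k) (4 + e))
  T[4+m] : T (4 + m) ≡ 5 + 2 * m + 2 * k + U + (4 + e)
  T[4+m] = begin
    T (4 + m)                        ≡⟨ T-suc (3 + m) ⟩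
    T (3 + m) + (4 + m)              ≡⟨ cong (_+ (4 + m)) (T-suc (2 + m)) ⟩
    T (2 + m) + (3 + m) + (4 + m)    ≡⟨ cong (λ z → z + (3 + m) + (4 + m)) (sum-upTo+n≡T (2 + m)) ⟨
    U + (2 + m) + (3 + m) + (4 + m)  ≡⟨ regroup k e U ⟩
    5 + 2 * m + 2 * k + U + (4 + e)  ∎
  c+U≡5+2m+2k+U : c + U ≡ 5 + 2 * m + 2 * k + U
  c+U≡5+2m+2k+U = begin
    c + U                                       ≡⟨ c+U≡ ⟩
    T (4 + m) ∸ (4 + m ∸ 2 * k)                 ≡⟨ cong₂ _∸_ T[4+m] 4+m∸2k≡4+e ⟩
    5 + 2 * m + 2 * k + U + (4 + e) ∸ (4 + e)   ≡⟨ m+n∸n≡m _ (4 + e) ⟩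
    5 + 2 * m + 2 * k + U                       ∎

n≡4+[2k+e] : ∀ n k → 2 ≤ 2 * k → 2 * k ≤ n ∸ 4 → ∃[ e ] n ≡ 4 + (2 * k + e)
n≡4+[2k+e] (suc (suc (suc (suc m)))) k _ 2k≤m = m ∸ 2 * k , cong (4 +_) (sym (m+[n∸m]≡n 2k≤m))
n≡4+[2k+e] 0 k 2≤2k 2k≤0 = contradiction (≤-trans 2≤2k 2k≤0) λ ()
n≡4+[2k+e] 1 k 2≤2k 2k≤0 = contradiction (≤-trans 2≤2k 2k≤0) λ ()
n≡4+[2k+e] 2 k 2≤2k 2k≤0 = contradiction (≤-trans 2≤2k 2k≤0) λ ()
n≡4+[2k+e] 3 k 2≤2k 2k≤0 = contradiction (≤-trans 2≤2k 2k≤0) λ ()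

proposition4p5 : (n k : ℕ) → 2 ≤ 2 * k → 2 * k ≤ n ∸ 4 →
    (lam : List ℕ) → InUbar (Tnd n (n ∸ 2 * k)) lam → largest lam ≡ 2 * n ∸ 5 →
    (cells (rows lam) ≡ 2 * n ∸ 3 + 2 * k)
      × (diagonalHookSum (rows lam) ≡ 2 * n ∸ 3 + 2 * k)
proposition4p5 n k 2≤2k 2k≤n∸4 lam ((linked , 0<lam , _) , _ , _ , sum≡ , missing≡) largest≡
  with e , refl ← n≡4+[2k+e] n k 2≤2k 2k≤n∸4 =
  cells≡ , trans (diagonalHookSum≡cells (rows-sorted lam<)) cells≡
  where
  m = 2 * k + e
  lam< : AllPairs _<_ lam
  lam< = Linked⇒AllPairs <-trans linked
  L≡ : largest lam ≡ 1 + suc m * 2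
  L≡ = trans largest≡ (2[4+m]∸5≡1+[1+m]*2 m)
  length≡ : length lam ≡ 2 + m
  length≡ = complement-of-half-odd (suc m)
    (trans (length-missing lam< 0<lam) L≡) (trans missing≡ (cong (_/ 2) L≡))
  cells≡ : cells (rows lam) ≡ 2 * (4 + m) ∸ 3 + 2 * k
  cells≡ = cells-arithmetic k e (cells (rows lam)) (begin
    cells (rows lam) + sum (upTo (2 + m))       ≡⟨ cong (λ t → cells (rows lam) + sum (upTo t)) length≡ ⟨
    cells (rows lam) + sum (upTo (length lam))  ≡⟨ cells-rows lam< ⟩
    sum lam                                      ≡⟨ sum≡ ⟩
    Tnd (4 + m) (4 + m ∸ 2 * k)                  ∎)
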